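{- Let $n\in\mathbb{N}$ and let $A(u)$ be an $\mathcal{L}$-formula, whose only free variable is $u$, with parameters from $D_n$ and containing only the predicate symbol $P$. Then for any $m_1,m_2\geq n+2$, $\mathcal{M}_S,n\models A(m_1)\leftrightarrow A(m_2)$.
   Context: Language $\mathcal{L}$: individual variables, $\top,\bot$, $\neg,\to$, $\forall$, $\Box$, and predicate symbols; $P$ is a fixed unary predicate symbol. Kripke models $\langle W,\prec,\{D_w\},\Vdash\rangle$ with increasing domains ($D_w\subseteq D_{w'}$ when $w\prec w'$); truth of sentences with parameters from $D_w$ at world $w$ is standard: atomic by $\Vdash$, $\forall u B(u)$ true at $w$ iff $B(a)$ true at $w$ for all $a\in D_w$, $\Box B$ true at $w$ iff $B$ true at all $v$ with $w\prec v$. Smoryński's model $\mathcal{M}_S=\langle W,\prec,\{D_n\}_{n\in W},\Vdash\rangle$: $W=\mathbb{N}$; $m\prec n$ iff $n<m$; $D_n=\{m\in\mathbb{N}: m\geq n\}$; $n\Vdash P(m)$ iff $m\neq n+1$. -}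

module Defs where

open import Data.Nat using (ℕ; zero; suc; _≤_; _<_; _+_)
open import Data.Fin using (Fin)
open import Data.Unit using (⊤)
open import Data.Empty using (⊥)
open import Data.Product using (_×_)
open import Relation.Binary.PropositionalEquality using (_≢_)

-- Terms with at most k free (de Bruijn) variables; parameters are natural
-- numbers (elements of the domains of Smoryński's model).
data Term (k : ℕ) : Set where
  var : Fin k → Term k
  par : ℕ → Term k

data Form (k : ℕ) : Set where
  ⊤′  : Form k
  ⊥′  : Form k
  ¬′_ : Form k → Form k
  _⇒_ : Form k → Form k → Form k
  ∀′  : Form (suc k) → Form k
  □_  : Form k → Form k
  P   : Term k → Form k

_≺_ : ℕ → ℕ → Set
m ≺ n = n < m

D : ℕ → ℕ → Set
D n m = n ≤ m

_⊩P_ : ℕ → ℕ → Set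
n ⊩P m = m ≢ suc n

Env : ℕ → Set
Env k = Fin k → ℕ

extend : ∀ {k} → ℕ → Env k → Env (suc k)
extend a ρ Fin.zero    = a
extend a ρ (Fin.suc i) = ρ i

⟦_⟧t : ∀ {k} → Term k → Env k → ℕ
⟦ var i ⟧t ρ = ρ i
⟦ par a ⟧t ρ = a

-- Truth at world w in M_S (variables interpreted via ρ, i.e. truth of the
-- sentence obtained by substituting ρ for the variables).
Sat : ∀ {k} → ℕ → Env k → Form k → Set
Sat w ρ ⊤′      = ⊤
Sat w ρ ⊥′      = ⊥
Sat w ρ (¬′ A)  = Sat w ρ A → ⊥
Sat w ρ (A ⇒ B) = Sat w ρ A → Sat w ρ B
Sat w ρ (∀′ A)  = (a : ℕ) → D w a → Sat w (extend a ρ) A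
Sat w ρ (□ A)   = (v : ℕ) → w ≺ v → Sat v ρ A
Sat w ρ (P t)   = w ⊩P (⟦ t ⟧t ρ)

ParamsTerm : ∀ {k} → ℕ → Term k → Set
ParamsTerm n (var i) = ⊤
ParamsTerm n (par a) = D n a

Params : ∀ {k} → ℕ → Form k → Set
Params n ⊤′      = ⊤
Params n ⊥′      = ⊤
Params n (¬′ A)  = Params n A
Params n (A ⇒ B) = Params n A × Params n B
Params n (∀′ A)  = Params n A
Params n (□ A)   = Params n A
Params n (P t)   = ParamsTerm n t

[_] : ℕ → Env 1
[ m ] _ = m

module Submission where

-- In Smoryński's model a world w sees P fail only at the single
-- element w+1.  Hence at every world w ≤ n, all elements ≥ n+2 satisfy P and
-- are therefore indistinguishable by atomic formulas.  Worlds reachable from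
-- n are again ≤ n, and quantifiers extend environments by the same element on
-- both sides, so by induction on formulas the relation
--     "x ≡ y, or both x and y are ≥ n+2"
-- on environments preserves truth at every world w ≤ n.

open import Defs
open import Data.Nat using (ℕ; _≤_; _+_; suc; s≤s)
open import Data.Nat.Properties using (≤-trans; ≤-refl; <⇒≤; +-comm; n≮n)
open import Data.Fin using (Fin)
open import Data.Sum using (_⊎_; inj₁; inj₂)
open import Data.Product using (_×_; _,_)
open import Function.Bundles using (_⇔_; mk⇔)
open import Relation.Binary.PropositionalEquality using (_≡_; refl; sym; subst)

-- Every world w ≤ n forces P on every element x ≥ n+2: the only element on
-- which P fails at w is w+1 ≤ n+1.
forces-P-above : ∀ {n w x} → w ≤ n → n + 2 ≤ x → w ⊩P x
forces-P-above {n} {w} w≤n n+2≤x refl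
  with subst (_≤ suc w) (+-comm n 2) n+2≤x
... | s≤s n<w = n≮n _ (≤-trans n<w w≤n)

Indist : ℕ → ℕ → ℕ → Set
Indist n x y = x ≡ y ⊎ (n + 2 ≤ x × n + 2 ≤ y)

Indist-sym : ∀ {n x y} → Indist n x y → Indist n y x
Indist-sym (inj₁ x≡y)       = inj₁ (sym x≡y)
Indist-sym (inj₂ (x≥ , y≥)) = inj₂ (y≥ , x≥)

P-invariant : ∀ {n w x y} → w ≤ n → Indist n x y → w ⊩P x → w ⊩P y
P-invariant w≤n (inj₁ refl)     wPx = wPx
P-invariant w≤n (inj₂ (_ , y≥)) _   = forces-P-above w≤n y≥

IndistEnv : ∀ {k} → ℕ → Env k → Env k → Set
IndistEnv n ρ ρ′ = ∀ i → Indist n (ρ i) (ρ′ i)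

IndistEnv-sym : ∀ {k n} {ρ ρ′ : Env k} → IndistEnv n ρ ρ′ → IndistEnv n ρ′ ρ
IndistEnv-sym ρ~ρ′ i = Indist-sym (ρ~ρ′ i)

IndistEnv-extend : ∀ {k n} {ρ ρ′ : Env k} a →
                   IndistEnv n ρ ρ′ → IndistEnv n (extend a ρ) (extend a ρ′)
IndistEnv-extend a ρ~ρ′ Fin.zero    = inj₁ refl
IndistEnv-extend a ρ~ρ′ (Fin.suc i) = ρ~ρ′ i

term-indist : ∀ {k n} {ρ ρ′ : Env k} (t : Term k) →
              IndistEnv n ρ ρ′ → Indist n (⟦ t ⟧t ρ) (⟦ t ⟧t ρ′)
term-indist (var i) ρ~ρ′ = ρ~ρ′ i
term-indist (par a) ρ~ρ′ = inj₁ refl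

-- Implications and negations use the symmetric relation for
-- their antecedent; boxes move to worlds v < w, which are again ≤ n.
sat-transport : ∀ {k n w} (A : Form k) {ρ ρ′ : Env k} →
                w ≤ n → IndistEnv n ρ ρ′ → Sat w ρ A → Sat w ρ′ A
sat-transport ⊤′      w≤n ρ~ρ′ s = s
sat-transport ⊥′      w≤n ρ~ρ′ s = s
sat-transport (¬′ A)  w≤n ρ~ρ′ s =
  λ sA → s (sat-transport A w≤n (IndistEnv-sym ρ~ρ′) sA)
sat-transport (A ⇒ B) w≤n ρ~ρ′ s =
  λ sA → sat-transport B w≤n ρ~ρ′ (s (sat-transport A w≤n (IndistEnv-sym ρ~ρ′) sA))
sat-transport (∀′ A)  w≤n ρ~ρ′ s =
  λ a w≤a → sat-transport A w≤n (IndistEnv-extend a ρ~ρ′) (s a w≤a)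
sat-transport (□ A)   w≤n ρ~ρ′ s =
  λ v v<w → sat-transport A (≤-trans (<⇒≤ v<w) w≤n) ρ~ρ′ (s v v<w)
sat-transport (P t)   w≤n ρ~ρ′ s = P-invariant w≤n (term-indist t ρ~ρ′) s

-- Lemma 3.3: at world n, a formula in one free variable u cannot tell apart
-- two values of u that are both ≥ n+2.
lemma3p3 : (n : ℕ) (A : Form 1) → Params n A →
           (m₁ m₂ : ℕ) → n + 2 ≤ m₁ → n + 2 ≤ m₂ →
           Sat n [ m₁ ] A ⇔ Sat n [ m₂ ] A
lemma3p3 n A _ m₁ m₂ m₁≥ m₂≥ =
  mk⇔ (sat-transport A ≤-refl (λ _ → inj₂ (m₁≥ , m₂≥)))
      (sat-transport A ≤-refl (λ _ → inj₂ (m₂≥ , m₁≥)))
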